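{- Let $G$ be a simple undirected graph with node set $\{1,\dots,N\}$ and adjacency matrix $A$, let $1\le k\le N-1$ be an integer, and let $P_k$ be the $N\times N$ matrix whose $(i,j)$ entry is the number of paths of length $k$ from node $i$ to node $j$. For a set $S\subseteq\{1,\dots,N\}$ write $s_S=\sum_{v\in S}e_v$. Then $$P_k=\sum_{1\le i_0<i_1<\cdots<i_k\le N}\ \ \sum_{m=0}^{k-1}(-1)^m\sum_{0\le j_0<j_1<\cdots<j_{m-1}\le k}\left(\left(s_{S\setminus R}\,s_{S\setminus R}^{T}\right)\circ A\right)^{k},$$ where $S=\{i_0,\dots,i_k\}$ and $R=\{i_{j_0},\dots,i_{j_{m-1}}\}$ (with $R=\emptyset$ when $m=0$). Explicitly, for each such $S$ the bracketed term is $$\left(\left(s_S s_S^T\right)\circ A\right)^k-\sum_{j_0=0}^{k}\left(\left(\left(s_S-e_{i_{j_0}}\right)\left(s_S-e_{i_{j_0}}\right)^T\right)\circ A\right)^k+\sum_{j_0=0}^{k-1}\sum_{j_1=j_0+1}^{k}\left(\left(\left(s_S-e_{i_{j_0}}-e_{i_{j_1}}\right)\left(s_S-e_{i_{j_0}}-e_{i_{j_1}}\right)^T\right)\circ A\right)^k-\cdots+(-1)^{k-2}\sum_{0\le j_0<\cdots<j_{k-1}\le k}\left(\left(\left(s_S-\sum_{q=0}^{k-1}e_{i_{j_q}}\right)\left(s_S-\sum_{q=0}^{k-1}e_{i_{j_q}}\right)^T\right)\circ A\right)^k.$$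
   Context: $A$ is the symmetric $0$-$1$ matrix with $a_{ij}=1$ iff nodes $i$ and $j$ are linked, and $a_{ii}=0$. $e_v$ is the $N\times 1$ standard basis vector with $(e_v)_v=1$ and other entries $0$; $\circ$ is the Hadamard (entrywise) product. A walk of length $k$ from $i$ to $j$ is a sequence of nodes $n_0=i,n_1,\dots,n_k=j$ with consecutive nodes adjacent; a path of length $k$ is a walk of length $k$ in which all $k+1$ nodes are pairwise distinct. Paths are counted as ordered sequences from source $i$ to destination $j$. -}

module Defs where

open import Data.Nat as ℕ using (ℕ; zero; suc)
open import Data.Bool using (Bool; true; false; if_then_else_)
open import Data.Integer using (ℤ; 0ℤ; 1ℤ; -1ℤ; _+_; _*_; _^_)
open import Data.Fin using (Fin; zero; suc; inject₁; fromℕ)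
open import Data.Fin.Properties using (all?; _≟_)
open import Data.Fin.Subset using (Subset; _⊆_; _─_; ∣_∣)
open import Data.Fin.Subset.Properties using (_⊆?_)
open import Data.Vec using (Vec; []; _∷_; lookup)
open import Data.List using (List; []; _∷_; [_]; map; concatMap; allFin; filter; length; upTo; _++_; foldr)
open import Data.Product using (_×_)
open import Relation.Binary.PropositionalEquality using (_≡_)
open import Relation.Nullary using (Dec; yes; no)
open import Relation.Nullary.Decidable using (_×-dec_; _→-dec_)

-- Square integer matrices indexed by the node set Fin N (node v ↔ paper's node v+1).
Mat : ℕ → Set
Mat N = Fin N → Fin N → ℤ

∑ : ∀ {n} → (Fin n → ℤ) → ℤ
∑ {zero}  f = 0ℤ
∑ {suc n} f = f zero + ∑ (λ i → f (suc i))

idM : ∀ {N} → Mat N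
idM i j with i ≟ j
... | yes _ = 1ℤ
... | no  _ = 0ℤ

zeroM : ∀ {N} → Mat N
zeroM _ _ = 0ℤ

_+M_ : ∀ {N} → Mat N → Mat N → Mat N
(M +M M′) i j = M i j + M′ i j

_*M_ : ∀ {N} → Mat N → Mat N → Mat N
(M *M M′) i j = ∑ (λ l → M i l * M′ l j)

_·M_ : ∀ {N} → ℤ → Mat N → Mat N
(c ·M M) i j = c * M i j

_∘H_ : ∀ {N} → Mat N → Mat N → Mat N
(M ∘H M′) i j = M i j * M′ i j

_^M_ : ∀ {N} → Mat N → ℕ → Mat N
M ^M zero  = idM
M ^M suc k = M *M (M ^M k)

sumM : ∀ {N} → List (Mat N) → Mat N
sumM = foldr _+M_ zeroM

sVec : ∀ {N} → Subset N → Fin N → ℤ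
sVec S v = if lookup S v then 1ℤ else 0ℤ

outer : ∀ {N} → (Fin N → ℤ) → (Fin N → ℤ) → Mat N
outer x y i j = x i * y j

allSubsets : (n : ℕ) → List (Subset n)
allSubsets zero    = [ [] ]
allSubsets (suc n) = map (true ∷_) (allSubsets n) ++ map (false ∷_) (allSubsets n)

subsetsOfSize : (n m : ℕ) → List (Subset n)
subsetsOfSize n m = filter (λ S → ∣ S ∣ ℕ.≟ m) (allSubsets n)

subsetsOfSizeIn : ∀ {n} → Subset n → ℕ → List (Subset n)
subsetsOfSizeIn S m = filter (λ R → R ⊆? S) (subsetsOfSize _ m)

allSeqs : (N l : ℕ) → List (Vec (Fin N) l)
allSeqs N zero    = [ [] ]
allSeqs N (suc l) = concatMap (λ w → map (_∷ w) (allFin N)) (allSeqs N l)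

IsPath : ∀ {N} → Mat N → (k : ℕ) → Fin N → Fin N → Vec (Fin N) (suc k) → Set
IsPath A k i j w =
  (lookup w zero ≡ i) ×
  (lookup w (fromℕ k) ≡ j) ×
  (∀ (t : Fin k) → A (lookup w (inject₁ t)) (lookup w (suc t)) ≡ 1ℤ) ×
  (∀ (s t : Fin (suc k)) → lookup w s ≡ lookup w t → s ≡ t)

isPath? : ∀ {N} (A : Mat N) (k : ℕ) (i j : Fin N) → (w : Vec (Fin N) (suc k)) → Dec (IsPath A k i j w)
isPath? A k i j w =
  (lookup w zero ≟ i) ×-dec
  (lookup w (fromℕ k) ≟ j) ×-dec
  all? (λ t → Data.Integer._≟_ (A (lookup w (inject₁ t)) (lookup w (suc t))) 1ℤ) ×-dec
  all? (λ s → all? (λ t → (lookup w s ≟ lookup w t) →-dec (s ≟ t)))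
  where import Data.Integer

P : ∀ {N} → Mat N → ℕ → Mat N
P {N} A k i j = Data.Integer.+_ (length (filter (isPath? A k i j) (allSeqs N (suc k))))
  where import Data.Integer

masked : ∀ {N} → Mat N → Subset N → Mat N
masked A T = outer (sVec T) (sVec T) ∘H A

rhs : ∀ {N} → Mat N → ℕ → Mat N
rhs {N} A k =
  sumM (map (λ S →
    sumM (map (λ m →
      (-1ℤ ^ m) ·M sumM (map (λ R → masked A (S ─ R) ^M k) (subsetsOfSizeIn S m)))
      (upTo k)))
    (subsetsOfSize N (suc k)))

{-# OPTIONS --safe #-}
-- Expanding the powers entrywise, (((s_T s_Tᵀ) ∘ A)^k)_{ij} sums, over the walks w of length k from
-- i to j, the 0/1 weight of w times [nodes w ⊆ T].  The right-hand side is therefore a sum over walks,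
-- each weighted by Σ_{|S| = k+1} Σ_{R ⊆ S, |R| < k} (-1)^|R| [nodes w ⊆ S ∖ R].  For a walk of positive
-- weight, k ≥ 1 and the zero diagonal give nodes w at least two elements, so |S ∖ R| ≥ 2 and the
-- constraint |R| < k is automatic; inclusion–exclusion then reduces the inner sum to [S = nodes w] and
-- the coefficient to [|nodes w| = k+1], which says exactly that w is a path.

module Submission where

open import Defs
open import Data.Nat as ℕ using (ℕ; zero; suc; _≤_; _<_; _∸_; s≤s; z≤n)
import Data.Nat.Properties as ℕ
open import Data.Bool using (Bool; true; false; if_then_else_; _∧_)
import Data.Bool as Bool
open import Data.Bool.Properties using (∧-zeroʳ)
open import Data.Integer as ℤ using (ℤ; 0ℤ; 1ℤ; -1ℤ; _+_; _*_; _^_)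
open import Data.Integer.Properties
  using (+-identityˡ; +-identityʳ; +-assoc; *-assoc; *-identityˡ; *-identityʳ; *-zeroˡ; *-zeroʳ; *-distribˡ-+)
open import Data.Integer.Tactic.RingSolver using (solve-∀)
open import Data.Fin using (Fin; zero; suc; inject₁; fromℕ)
open import Data.Fin.Properties using (_≟_; all?)
import Data.Fin.Properties as Fin
open import Data.Fin.Subset using (Subset; _∈_; _∉_; _⊆_; _─_; _∪_; ⁅_⁆; ⊥; ∣_∣)
open import Data.Fin.Subset.Properties
  using (_⊆?_; _∈?_; ⊥⊆; ∉⊥; ∣⊥∣≡0; x∈⁅x⁆; x∈⁅y⁆⇒x≡y; p⊆p∪q; q⊆p∪q; x∈p∪q⁻; drop-∷-⊆;
         x∈p⇒∣p-x∣<∣p∣; x∈p∧x≢y⇒x∈p-y; ∪-identityˡ)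
open import Data.Vec using (Vec; []; _∷_; lookup; here; there)
open import Data.Vec.Properties using (≡-dec)
open import Data.List using (List; []; _∷_; [_]; map; concatMap; allFin; filter; length; upTo; tabulate; _++_; _∷ʳ_)
open import Data.List.Properties using (upTo-∷ʳ)
open import Data.Product using (_×_; _,_; ∃)
open import Data.Sum using (_⊎_; inj₁; inj₂)
open import Data.Empty using (⊥-elim)
open import Function using (_∘_; _⇔_; mk⇔)
open import Relation.Binary.Definitions using (DecidableEquality)
open import Relation.Binary.PropositionalEquality hiding ([_])
open import Relation.Nullary using (Dec; yes; no; does; ¬_; _×-dec_)
open import Relation.Nullary.Decidable using (dec-true; dec-false; does-⇔)
open import Relation.Unary using (Pred; Decidable)

-- Chosen so that sVec T x reduces to 𝟙 (lookup T x).
𝟙 : Bool → ℤ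
𝟙 b = if b then 1ℤ else 0ℤ

𝟙-∧ : ∀ a b → 𝟙 (a ∧ b) ≡ 𝟙 a * 𝟙 b
𝟙-∧ true  b = sym (*-identityˡ (𝟙 b))
𝟙-∧ false b = refl

𝟙-idem : ∀ b → 𝟙 b * 𝟙 b ≡ 𝟙 b
𝟙-idem true  = refl
𝟙-idem false = refl

𝟙-≟-sym : ∀ {n} (x y : Fin n) → 𝟙 (does (x ≟ y)) ≡ 𝟙 (does (y ≟ x))
𝟙-≟-sym x y = cong 𝟙 (does-⇔ (mk⇔ sym sym) (x ≟ y) (y ≟ x))

𝟙-*-cong : ∀ {p} {P : Set p} (p? : Dec P) {x y : ℤ} → (P → x ≡ y) → 𝟙 (does p?) * x ≡ 𝟙 (does p?) * y
𝟙-*-cong (yes p) x≡y = cong (1ℤ *_) (x≡y p)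
𝟙-*-cong (no _)  _   = refl

𝟙-guard : ∀ {p q} {P : Set p} {Q : Set q} (p? : Dec P) (q? : Dec Q) (x : ℤ) →
          (Q → P) → 𝟙 (does p?) * (x * 𝟙 (does q?)) ≡ x * 𝟙 (does q?)
𝟙-guard p? (yes q) x Q⇒P rewrite dec-true p? (Q⇒P q) = *-identityˡ _
𝟙-guard p? (no _)  x _   rewrite *-zeroʳ x = *-zeroʳ (𝟙 (does p?))

∑ˡ : ∀ {a} {A : Set a} → List A → (A → ℤ) → ℤ
∑ˡ []       f = 0ℤ
∑ˡ (x ∷ xs) f = f x + ∑ˡ xs f

infixr 5 ∑ˡ
syntax ∑ˡ L (λ x → e) = ∑[ x ← L ] e

module _ {a} {A : Set a} where

  ∑ˡ-cong : (L : List A) {f g : A → ℤ} → (∀ x → f x ≡ g x) → ∑ˡ L f ≡ ∑ˡ L g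
  ∑ˡ-cong []      f≗g = refl
  ∑ˡ-cong (x ∷ L) f≗g = cong₂ _+_ (f≗g x) (∑ˡ-cong L f≗g)

  ∑ˡ-zero : (L : List A) {f : A → ℤ} → (∀ x → f x ≡ 0ℤ) → ∑ˡ L f ≡ 0ℤ
  ∑ˡ-zero []      f≗0 = refl
  ∑ˡ-zero (x ∷ L) f≗0 = cong₂ _+_ (f≗0 x) (∑ˡ-zero L f≗0)

  ∑ˡ-++ : (L M : List A) (f : A → ℤ) → ∑ˡ (L ++ M) f ≡ ∑ˡ L f + ∑ˡ M f
  ∑ˡ-++ []      M f = sym (+-identityˡ _)
  ∑ˡ-++ (x ∷ L) M f rewrite ∑ˡ-++ L M f = sym (+-assoc (f x) _ _)

  ∑ˡ-+ : (L : List A) (f g : A → ℤ) → ∑[ x ← L ] (f x + g x) ≡ ∑ˡ L f + ∑ˡ L g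
  ∑ˡ-+ []      f g = refl
  ∑ˡ-+ (x ∷ L) f g rewrite ∑ˡ-+ L f g = interchange (f x) (g x) (∑ˡ L f) (∑ˡ L g)
    where
    interchange : ∀ a b c d → a + b + (c + d) ≡ a + c + (b + d)
    interchange = solve-∀

  *-∑ˡ : (L : List A) (c : ℤ) (f : A → ℤ) → c * ∑ˡ L f ≡ ∑[ x ← L ] c * f x
  *-∑ˡ []      c f = *-zeroʳ c
  *-∑ˡ (x ∷ L) c f = trans (*-distribˡ-+ c (f x) _) (cong ((c * f x) +_) (*-∑ˡ L c f))

  ∑ˡ-filter : ∀ {p} {P : Pred A p} (P? : Decidable P) (L : List A) (f : A → ℤ) →
              ∑ˡ (filter P? L) f ≡ ∑[ x ← L ] 𝟙 (does (P? x)) * f x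
  ∑ˡ-filter P? []      f = refl
  ∑ˡ-filter P? (x ∷ L) f with does (P? x)
  ... | true  = cong₂ _+_ (sym (*-identityˡ (f x))) (∑ˡ-filter P? L f)
  ... | false = trans (∑ˡ-filter P? L f) (sym (trans (cong (_+ rest) (*-zeroˡ (f x))) (+-identityˡ rest)))
    where rest = ∑[ y ← L ] 𝟙 (does (P? y)) * f y

  length-filter : ∀ {p} {P : Pred A p} (P? : Decidable P) (L : List A) →
                  ℤ.+ length (filter P? L) ≡ ∑[ x ← L ] 𝟙 (does (P? x))
  length-filter P? []      = refl
  length-filter P? (x ∷ L) with does (P? x)
  ... | true  = cong (1ℤ +_) (length-filter P? L)
  ... | false = trans (length-filter P? L) (sym (+-identityˡ _))

module _ {a b} {A : Set a} {B : Set b} where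

  ∑ˡ-map : (L : List A) (g : A → B) (f : B → ℤ) → ∑ˡ (map g L) f ≡ ∑ˡ L (f ∘ g)
  ∑ˡ-map []      g f = refl
  ∑ˡ-map (x ∷ L) g f = cong (f (g x) +_) (∑ˡ-map L g f)

  ∑ˡ-concatMap : (L : List A) (g : A → List B) (f : B → ℤ) →
                 ∑ˡ (concatMap g L) f ≡ ∑[ x ← L ] ∑ˡ (g x) f
  ∑ˡ-concatMap []      g f = refl
  ∑ˡ-concatMap (x ∷ L) g f = trans (∑ˡ-++ (g x) _ f) (cong (∑ˡ (g x) f +_) (∑ˡ-concatMap L g f))

  ∑ˡ-comm : (L : List A) (M : List B) (f : A → B → ℤ) →
            ∑[ x ← L ] ∑[ y ← M ] f x y ≡ ∑[ y ← M ] ∑[ x ← L ] f x y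
  ∑ˡ-comm []      M f = sym (∑ˡ-zero M (λ _ → refl))
  ∑ˡ-comm (x ∷ L) M f = trans (cong (∑ˡ M (f x) +_) (∑ˡ-comm L M f)) (sym (∑ˡ-+ M (f x) _))

∑ˡ-tabulate : ∀ {n} {B : Set} (g : Fin n → B) (f : B → ℤ) → ∑ˡ (tabulate g) f ≡ ∑ (f ∘ g)
∑ˡ-tabulate {zero}  g f = refl
∑ˡ-tabulate {suc n} g f = cong (f (g zero) +_) (∑ˡ-tabulate (g ∘ suc) f)

∑≡∑ˡ-allFin : ∀ {n} (f : Fin n → ℤ) → ∑ f ≡ ∑ˡ (allFin n) f
∑≡∑ˡ-allFin f = sym (∑ˡ-tabulate (λ i → i) f)

∑-zero : ∀ {n} (f : Fin n → ℤ) → (∀ x → f x ≡ 0ℤ) → ∑ f ≡ 0ℤ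
∑-zero {zero}  f f≗0 = refl
∑-zero {suc n} f f≗0 = cong₂ _+_ (f≗0 zero) (∑-zero (f ∘ suc) (f≗0 ∘ suc))

∑-δ : ∀ {n} (i : Fin n) (f : Fin n → ℤ) → ∑ (λ x → 𝟙 (does (x ≟ i)) * f x) ≡ f i
∑-δ zero    f = trans (cong (1ℤ * f zero +_) (∑-zero _ (λ x → *-zeroˡ (f (suc x)))))
                      (trans (+-identityʳ _) (*-identityˡ (f zero)))
∑-δ (suc i) f = trans (cong (_+ ∑ (λ x → 𝟙 (does (suc x ≟ suc i))* f (suc x))) (*-zeroˡ (f zero)))
                      (trans (+-identityˡ _) (∑-δ i (f ∘ suc)))

∑ˡ-allFin-δ : ∀ {n} (i : Fin n) (f : Fin n → ℤ) → ∑[ x ← allFin n ] 𝟙 (does (x ≟ i)) * f x ≡ f i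
∑ˡ-allFin-δ i f = trans (sym (∑≡∑ˡ-allFin (λ x → 𝟙 (does (x ≟ i)) * f x))) (∑-δ i f)

-- Walks and matrix powers

weight : ∀ {N k} → Mat N → Vec (Fin N) (suc k) → ℤ
weight M (x ∷ [])    = 1ℤ
weight M (x ∷ y ∷ w) = M x y * weight M (y ∷ w)

walkTerm : ∀ {N k} → Mat N → Fin N → Fin N → Vec (Fin N) (suc k) → ℤ
walkTerm {k = k} M i j w = 𝟙 (does (lookup w zero ≟ i)) * (𝟙 (does (lookup w (fromℕ k) ≟ j)) * weight M w)

∑ˡ-allSeqs-suc : ∀ N l (f : Vec (Fin N) (suc l) → ℤ) →
                 ∑ˡ (allSeqs N (suc l)) f ≡ ∑[ w ← allSeqs N l ] ∑[ x ← allFin N ] f (x ∷ w)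
∑ˡ-allSeqs-suc N l f = trans (∑ˡ-concatMap (allSeqs N l) (λ w → map (_∷ w) (allFin N)) f)
                             (∑ˡ-cong (allSeqs N l) (λ w → ∑ˡ-map (allFin N) (_∷ w) f))

idM≡𝟙 : ∀ {N} (i j : Fin N) → idM i j ≡ 𝟙 (does (i ≟ j))
idM≡𝟙 i j with i ≟ j
... | yes _ = refl
... | no  _ = refl

walkTerm-∷ : ∀ {N k} (M : Mat N) i j (w : Vec (Fin N) (suc k)) →
             ∑[ l ← allFin N ] M i l * walkTerm M l j w ≡ ∑[ x ← allFin N ] walkTerm M i j (x ∷ w)
walkTerm-∷ {N} {k} M i j (y ∷ w) = begin
    ∑[ l ← allFin N ] M i l * (𝟙 (does (y ≟ l)) * e)
  ≡⟨ ∑ˡ-cong (allFin N) (λ l → trans (swap (M i l) (𝟙 (does (y ≟ l))) e) (cong (_* (M i l * e)) (𝟙-≟-sym y l))) ⟩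
    ∑[ l ← allFin N ] 𝟙 (does (l ≟ y)) * (M i l * e)
  ≡⟨ ∑ˡ-allFin-δ y (λ l → M i l * e) ⟩
    M i y * e
  ≡⟨ sym (∑ˡ-allFin-δ i (λ x → M x y * e)) ⟩
    ∑[ x ← allFin N ] 𝟙 (does (x ≟ i)) * (M x y * e)
  ≡⟨ ∑ˡ-cong (allFin N) (λ x → cong (𝟙 (does (x ≟ i)) *_) (swap (M x y) ends (weight M (y ∷ w)))) ⟩
    ∑[ x ← allFin N ] walkTerm M i j (x ∷ y ∷ w) ∎
  where
  open ≡-Reasoning
  ends e : ℤ
  ends = 𝟙 (does (lookup (y ∷ w) (fromℕ k) ≟ j))
  e    = ends * weight M (y ∷ w)
  swap : ∀ a b c → a * (b * c) ≡ b * (a * c)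
  swap = solve-∀

^M≡walkSum : ∀ {N} (M : Mat N) k i j → (M ^M k) i j ≡ ∑ˡ (allSeqs N (suc k)) (walkTerm M i j)
^M≡walkSum {N} M zero i j = sym (begin
    ∑ˡ (allSeqs N 1) (walkTerm M i j)
  ≡⟨ ∑ˡ-allSeqs-suc N 0 (walkTerm M i j) ⟩
    (∑[ x ← allFin N ] 𝟙 (does (x ≟ i)) * (𝟙 (does (x ≟ j)) * 1ℤ)) + 0ℤ
  ≡⟨ +-identityʳ _ ⟩
    ∑[ x ← allFin N ] 𝟙 (does (x ≟ i)) * (𝟙 (does (x ≟ j)) * 1ℤ)
  ≡⟨ ∑ˡ-allFin-δ i _ ⟩
    𝟙 (does (i ≟ j)) * 1ℤ
  ≡⟨ trans (*-identityʳ _) (sym (idM≡𝟙 i j)) ⟩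
    idM i j ∎)
  where open ≡-Reasoning
^M≡walkSum {N} M (suc k) i j = begin
    ∑ (λ l → M i l * (M ^M k) l j)
  ≡⟨ ∑≡∑ˡ-allFin (λ l → M i l * (M ^M k) l j) ⟩
    ∑[ l ← allFin N ] M i l * (M ^M k) l j
  ≡⟨ ∑ˡ-cong (allFin N) (λ l → trans (cong (M i l *_) (^M≡walkSum M k l j)) (*-∑ˡ W (M i l) _)) ⟩
    ∑[ l ← allFin N ] ∑[ w ← W ] M i l * walkTerm M l j w
  ≡⟨ ∑ˡ-comm (allFin N) W _ ⟩
    ∑[ w ← W ] ∑[ l ← allFin N ] M i l * walkTerm M l j w
  ≡⟨ ∑ˡ-cong W (walkTerm-∷ M i j) ⟩
    ∑[ w ← W ] ∑[ x ← allFin N ] walkTerm M i j (x ∷ w)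
  ≡⟨ sym (∑ˡ-allSeqs-suc N (suc k) (walkTerm M i j)) ⟩
    ∑ˡ (allSeqs N (suc (suc k))) (walkTerm M i j) ∎
  where
  open ≡-Reasoning
  W = allSeqs N (suc k)

nodes : ∀ {N n} → Vec (Fin N) n → Subset N
nodes []      = ⊥
nodes (x ∷ w) = ⁅ x ⁆ ∪ nodes w

Distinct : ∀ {a} {A : Set a} {n} → Vec A n → Set a
Distinct w = ∀ s t → lookup w s ≡ lookup w t → s ≡ t

⁅x⁆∪p≡p : ∀ {n} {x : Fin n} (p : Subset n) → x ∈ p → ⁅ x ⁆ ∪ p ≡ p
⁅x⁆∪p≡p {x = zero}  (true ∷ p) here        = cong (true ∷_) (∪-identityˡ p)
⁅x⁆∪p≡p {x = suc x} (b ∷ p)    (there x∈p) = cong (b ∷_) (⁅x⁆∪p≡p p x∈p)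

∣⁅x⁆∪p∣≡1+∣p∣ : ∀ {n} {x : Fin n} (p : Subset n) → x ∉ p → ∣ ⁅ x ⁆ ∪ p ∣ ≡ suc ∣ p ∣
∣⁅x⁆∪p∣≡1+∣p∣ {x = zero}  (true  ∷ p) x∉p = ⊥-elim (x∉p here)
∣⁅x⁆∪p∣≡1+∣p∣ {x = zero}  (false ∷ p) x∉p = cong (suc ∘ ∣_∣) (∪-identityˡ p)
∣⁅x⁆∪p∣≡1+∣p∣ {x = suc x} (true  ∷ p) x∉p = cong suc (∣⁅x⁆∪p∣≡1+∣p∣ p (x∉p ∘ there))
∣⁅x⁆∪p∣≡1+∣p∣ {x = suc x} (false ∷ p) x∉p = ∣⁅x⁆∪p∣≡1+∣p∣ p (x∉p ∘ there)

⁅x⁆∪p⊆?q : ∀ {n} (x : Fin n) (p q : Subset n) → does (⁅ x ⁆ ∪ p ⊆? q) ≡ lookup q x ∧ does (p ⊆? q)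
⁅x⁆∪p⊆?q zero    (b     ∷ p) (false ∷ q) = refl
⁅x⁆∪p⊆?q zero    (true  ∷ p) (true  ∷ q) rewrite ∪-identityˡ p = refl
⁅x⁆∪p⊆?q zero    (false ∷ p) (true  ∷ q) rewrite ∪-identityˡ p = refl
⁅x⁆∪p⊆?q (suc x) (false ∷ p) (c     ∷ q) = ⁅x⁆∪p⊆?q x p q
⁅x⁆∪p⊆?q (suc x) (true  ∷ p) (true  ∷ q) = ⁅x⁆∪p⊆?q x p q
⁅x⁆∪p⊆?q (suc x) (true  ∷ p) (false ∷ q) = sym (∧-zeroʳ (lookup q x))

∣p─q∣+∣q∣≡∣p∣ : ∀ {n} (p q : Subset n) → q ⊆ p → ∣ p ─ q ∣ ℕ.+ ∣ q ∣ ≡ ∣ p ∣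
∣p─q∣+∣q∣≡∣p∣ []      []      _   = refl
∣p─q∣+∣q∣≡∣p∣ (true  ∷ p) (true  ∷ q) q⊆p =
  trans (ℕ.+-suc _ _) (cong suc (∣p─q∣+∣q∣≡∣p∣ p q (drop-∷-⊆ q⊆p)))
∣p─q∣+∣q∣≡∣p∣ (false ∷ p) (true  ∷ q) q⊆p with q⊆p here
... | ()
∣p─q∣+∣q∣≡∣p∣ (true  ∷ p) (false ∷ q) q⊆p = cong suc (∣p─q∣+∣q∣≡∣p∣ p q (drop-∷-⊆ q⊆p))
∣p─q∣+∣q∣≡∣p∣ (false ∷ p) (false ∷ q) q⊆p = ∣p─q∣+∣q∣≡∣p∣ p q (drop-∷-⊆ q⊆p)

2≤∣p∣ : ∀ {n} {p : Subset n} {x y} → x ∈ p → y ∈ p → x ≢ y → 2 ≤ ∣ p ∣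
2≤∣p∣ x∈p y∈p x≢y =
  ℕ.≤-trans (s≤s (s≤s z≤n))
            (ℕ.≤-trans (s≤s (x∈p⇒∣p-x∣<∣p∣ (x∈p∧x≢y⇒x∈p-y y∈p (x≢y ∘ sym))))
                       (x∈p⇒∣p-x∣<∣p∣ x∈p))

module _ {N : ℕ} where

  lookup∈nodes : ∀ {n} (w : Vec (Fin N) n) t → lookup w t ∈ nodes w
  lookup∈nodes (x ∷ w) zero    = p⊆p∪q (nodes w) (x∈⁅x⁆ x)
  lookup∈nodes (x ∷ w) (suc t) = q⊆p∪q ⁅ x ⁆ (nodes w) (lookup∈nodes w t)

  ∈nodes⇒lookup : ∀ {n} (w : Vec (Fin N) n) {z} → z ∈ nodes w → ∃ λ t → lookup w t ≡ z
  ∈nodes⇒lookup []      z∈ = ⊥-elim (∉⊥ z∈)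
  ∈nodes⇒lookup (x ∷ w) z∈ with x∈p∪q⁻ ⁅ x ⁆ (nodes w) z∈
  ... | inj₁ z∈⁅x⁆ = zero , sym (x∈⁅y⁆⇒x≡y x z∈⁅x⁆)
  ... | inj₂ z∈w with ∈nodes⇒lookup w z∈w
  ...   | t , wₜ≡z = suc t , wₜ≡z

  ∣nodes∣≤length : ∀ {n} (w : Vec (Fin N) n) → ∣ nodes w ∣ ≤ n
  ∣nodes∣≤length []      = ℕ.≤-reflexive (∣⊥∣≡0 N)
  ∣nodes∣≤length (x ∷ w) with x ∈? nodes w
  ... | yes x∈w = ℕ.≤-trans (ℕ.≤-reflexive (cong ∣_∣ (⁅x⁆∪p≡p (nodes w) x∈w)))
                            (ℕ.m≤n⇒m≤1+n (∣nodes∣≤length w))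
  ... | no  x∉w = ℕ.≤-trans (ℕ.≤-reflexive (∣⁅x⁆∪p∣≡1+∣p∣ (nodes w) x∉w)) (s≤s (∣nodes∣≤length w))

  distinct⇒∣nodes∣≡length : ∀ {n} (w : Vec (Fin N) n) → Distinct w → ∣ nodes w ∣ ≡ n
  distinct⇒∣nodes∣≡length []      _ = ∣⊥∣≡0 N
  distinct⇒∣nodes∣≡length (x ∷ w) d with x ∈? nodes w
  ... | yes x∈w with ∈nodes⇒lookup w x∈w
  ...   | t , wₜ≡x with d (suc t) zero wₜ≡x
  ...     | ()
  distinct⇒∣nodes∣≡length (x ∷ w) d | no x∉w =
    trans (∣⁅x⁆∪p∣≡1+∣p∣ (nodes w) x∉w)
          (cong suc (distinct⇒∣nodes∣≡length w (λ s t e → Fin.suc-injective (d (suc s) (suc t) e))))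

  ∣nodes∣≡length⇒distinct : ∀ {n} (w : Vec (Fin N) n) → ∣ nodes w ∣ ≡ n → Distinct w
  ∣nodes∣≡length⇒distinct (x ∷ w) eq with x ∈? nodes w
  ... | yes x∈w =
    ⊥-elim (ℕ.1+n≰n (subst (_≤ _) (trans (sym (cong ∣_∣ (⁅x⁆∪p≡p (nodes w) x∈w))) eq) (∣nodes∣≤length w)))
  ... | no  x∉w = distinct
    where
    distinct-w : Distinct w
    distinct-w = ∣nodes∣≡length⇒distinct w (ℕ.suc-injective (trans (sym (∣⁅x⁆∪p∣≡1+∣p∣ (nodes w) x∉w)) eq))
    x≢wₜ : ∀ t → x ≢ lookup w t
    x≢wₜ t x≡wₜ = x∉w (subst (_∈ nodes w) (sym x≡wₜ) (lookup∈nodes w t))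
    distinct : Distinct (x ∷ w)
    distinct zero    zero    _ = refl
    distinct zero    (suc t) e = ⊥-elim (x≢wₜ t e)
    distinct (suc s) zero    e = ⊥-elim (x≢wₜ s (sym e))
    distinct (suc s) (suc t) e = cong suc (distinct-w s t e)

  𝟙-nodes⊆-∷ : ∀ {n} (x : Fin N) (w : Vec (Fin N) n) (T : Subset N) →
               𝟙 (does (nodes (x ∷ w) ⊆? T)) ≡ sVec T x * 𝟙 (does (nodes w ⊆? T))
  𝟙-nodes⊆-∷ x w T = trans (cong 𝟙 (⁅x⁆∪p⊆?q x (nodes w) T)) (𝟙-∧ (lookup T x) _)

weight-masked : ∀ {N k} (A : Mat N) (T : Subset N) (w : Vec (Fin N) (suc (suc k))) →
                weight (masked A T) w ≡ weight A w * 𝟙 (does (nodes w ⊆? T))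
weight-masked A T (x ∷ y ∷ []) = begin
    sx * sy * A x y * 1ℤ
  ≡⟨ reorder sx sy (A x y) ⟩
    A x y * 1ℤ * (sx * (sy * 1ℤ))
  ≡⟨ cong (λ z → A x y * 1ℤ * (sx * (sy * 𝟙 z))) (sym (dec-true (⊥ ⊆? T) ⊥⊆)) ⟩
    A x y * 1ℤ * (sx * (sy * 𝟙 (does (⊥ ⊆? T))))
  ≡⟨ cong (λ z → A x y * 1ℤ * (sx * z)) (sym (𝟙-nodes⊆-∷ y [] T)) ⟩
    A x y * 1ℤ * (sx * 𝟙 (does (nodes (y ∷ []) ⊆? T)))
  ≡⟨ cong (A x y * 1ℤ *_) (sym (𝟙-nodes⊆-∷ x (y ∷ []) T)) ⟩
    A x y * 1ℤ * 𝟙 (does (nodes (x ∷ y ∷ []) ⊆? T)) ∎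
  where
  open ≡-Reasoning
  sx = sVec T x
  sy = sVec T y
  reorder : ∀ a b c → a * b * c * 1ℤ ≡ c * 1ℤ * (a * (b * 1ℤ))
  reorder = solve-∀
-- Consecutive edges xy and yz both mask y, so its indicator appears squared.
weight-masked A T (x ∷ y ∷ z ∷ w) = begin
    sx * sy * A x y * weight (masked A T) (y ∷ z ∷ w)
  ≡⟨ cong (sx * sy * A x y *_) (trans (weight-masked A T (y ∷ z ∷ w)) (cong (wy *_) (𝟙-nodes⊆-∷ y (z ∷ w) T))) ⟩
    sx * sy * A x y * (wy * (sy * I))
  ≡⟨ reorder sx sy (A x y) wy I ⟩
    sy * sy * (A x y * wy * (sx * I))
  ≡⟨ cong (λ s → s * (A x y * wy * (sx * I))) (𝟙-idem (lookup T y)) ⟩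
    sy * (A x y * wy * (sx * I))
  ≡⟨ reorder′ sx sy (A x y) wy I ⟩
    A x y * wy * (sx * (sy * I))
  ≡⟨ cong (λ s → A x y * wy * (sx * s)) (sym (𝟙-nodes⊆-∷ y (z ∷ w) T)) ⟩
    A x y * wy * (sx * 𝟙 (does (nodes (y ∷ z ∷ w) ⊆? T)))
  ≡⟨ cong (A x y * wy *_) (sym (𝟙-nodes⊆-∷ x (y ∷ z ∷ w) T)) ⟩
    A x y * wy * 𝟙 (does (nodes (x ∷ y ∷ z ∷ w) ⊆? T)) ∎
  where
  open ≡-Reasoning
  sx = sVec T x
  sy = sVec T y
  wy = weight A (y ∷ z ∷ w)
  I  = 𝟙 (does (nodes (z ∷ w) ⊆? T))
  reorder : ∀ a b c d e → a * b * c * (d * (b * e)) ≡ b * b * (c * d * (a * e))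
  reorder = solve-∀
  reorder′ : ∀ a b c d e → b * (c * d * (a * e)) ≡ c * d * (a * (b * e))
  reorder′ = solve-∀

masked^M≡walkSum : ∀ {N} (A : Mat N) (T : Subset N) k i j →
                   (masked A T ^M suc k) i j ≡
                   ∑[ w ← allSeqs N (suc (suc k)) ] walkTerm A i j w * 𝟙 (does (nodes w ⊆? T))
masked^M≡walkSum {N} A T k i j =
  trans (^M≡walkSum (masked A T) (suc k) i j) (∑ˡ-cong (allSeqs N (suc (suc k))) masked-term)
  where
  reassoc : ∀ a b c d → a * (b * (c * d)) ≡ a * (b * c) * d
  reassoc = solve-∀
  masked-term : ∀ w → walkTerm (masked A T) i j w ≡ walkTerm A i j w * 𝟙 (does (nodes w ⊆? T))
  masked-term w = trans (cong (λ z → h * (l * z)) (weight-masked A T w))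
                        (reassoc h l (weight A w) (𝟙 (does (nodes w ⊆? T))))
    where
    h = 𝟙 (does (lookup w zero ≟ i))
    l = 𝟙 (does (lookup w (fromℕ (suc k)) ≟ j))

-- The right-hand side as a sum over walks

sumM-map : ∀ {a} {A : Set a} {N} (L : List A) (F : A → Mat N) i j →
           sumM (map F L) i j ≡ ∑[ x ← L ] F x i j
sumM-map []      F i j = refl
sumM-map (x ∷ L) F i j = cong (F x i j +_) (sumM-map L F i j)

module _ {b} {B : Set b} (W : List B) (c : B → ℤ) where

  ∑ˡ-weighted : ∀ {a} {A : Set a} (L : List A) {X : A → ℤ} {d : A → B → ℤ} →
                (∀ x → X x ≡ ∑[ w ← W ] c w * d x w) →
                ∑ˡ L X ≡ ∑[ w ← W ] c w * (∑[ x ← L ] d x w)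
  ∑ˡ-weighted L {X} {d} X≡ = begin
      ∑ˡ L X                           ≡⟨ ∑ˡ-cong L X≡ ⟩
      ∑[ x ← L ] ∑[ w ← W ] c w * d x w ≡⟨ ∑ˡ-comm L W _ ⟩
      ∑[ w ← W ] ∑[ x ← L ] c w * d x w ≡⟨ ∑ˡ-cong W (λ w → sym (*-∑ˡ L (c w) (λ x → d x w))) ⟩
      ∑[ w ← W ] c w * (∑[ x ← L ] d x w) ∎
    where open ≡-Reasoning

  *-weighted : ∀ s {X : ℤ} {d : B → ℤ} → X ≡ ∑[ w ← W ] c w * d w → s * X ≡ ∑[ w ← W ] c w * (s * d w)
  *-weighted s {d = d} refl = trans (*-∑ˡ W s _) (∑ˡ-cong W (λ w → swap s (c w) (d w)))
    where
    swap : ∀ a b e → a * (b * e) ≡ b * (a * e)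
    swap = solve-∀

  sumM-weighted : ∀ {a} {A : Set a} {N} (L : List A) (F : A → Mat N) {i j} {d : A → B → ℤ} →
                  (∀ x → F x i j ≡ ∑[ w ← W ] c w * d x w) →
                  sumM (map F L) i j ≡ ∑[ w ← W ] c w * (∑[ x ← L ] d x w)
  sumM-weighted L F {i} {j} F≡ = trans (sumM-map L F i j) (∑ˡ-weighted L F≡)

rhsCoefficient : ∀ {N} → ℕ → Subset N → ℤ
rhsCoefficient {N} K V =
  ∑[ S ← subsetsOfSize N (suc K) ] ∑[ m ← upTo K ] -1ℤ ^ m * (∑[ R ← subsetsOfSizeIn S m ] 𝟙 (does (V ⊆? S ─ R)))

rhs≡walkSum : ∀ {N} (A : Mat N) k i j →
              rhs A (suc k) i j ≡ ∑[ w ← allSeqs N (suc (suc k)) ] walkTerm A i j w * rhsCoefficient (suc k) (nodes w)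
rhs≡walkSum {N} A k i j =
  sumM-weighted W c (subsetsOfSize N (suc K)) (λ S → sumM (map (term S) (upTo K))) λ S →
  sumM-weighted W c (upTo K) (term S) λ m →
  *-weighted W c (-1ℤ ^ m) (sumM-weighted W c (subsetsOfSizeIn S m) (λ R → masked A (S ─ R) ^M K) λ R →
  masked^M≡walkSum A (S ─ R) k i j)
  where
  K = suc k
  W = allSeqs N (suc K)
  c = walkTerm A i j
  term : Subset N → ℕ → Mat N
  term S m = (-1ℤ ^ m) ·M sumM (map (λ R → masked A (S ─ R) ^M K) (subsetsOfSizeIn S m))

-- Inclusion–exclusion

_≟ₛ_ : ∀ {n} → DecidableEquality (Subset n)
_≟ₛ_ = ≡-dec Bool._≟_

∑ˡ-allSubsets-suc : ∀ n (f : Subset (suc n) → ℤ) →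
                    ∑ˡ (allSubsets (suc n)) f ≡ ∑ˡ (allSubsets n) (f ∘ (true ∷_)) + ∑ˡ (allSubsets n) (f ∘ (false ∷_))
∑ˡ-allSubsets-suc n f = trans (∑ˡ-++ (map (true ∷_) (allSubsets n)) _ f)
                              (cong₂ _+_ (∑ˡ-map (allSubsets n) (true ∷_) f) (∑ˡ-map (allSubsets n) (false ∷_) f))

∑ˡ-allSubsets-δ : ∀ n (V : Subset n) (f : Subset n → ℤ) → ∑[ S ← allSubsets n ] f S * 𝟙 (does (S ≟ₛ V)) ≡ f V
∑ˡ-allSubsets-δ zero    []          f = trans (+-identityʳ _) (*-identityʳ _)
∑ˡ-allSubsets-δ (suc n) (true  ∷ V) f =
  trans (∑ˡ-allSubsets-suc n _)
        (trans (cong₂ _+_ (∑ˡ-allSubsets-δ n V (f ∘ (true ∷_))) (∑ˡ-zero (allSubsets n) (λ S → *-zeroʳ (f (false ∷ S)))))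
               (+-identityʳ _))
∑ˡ-allSubsets-δ (suc n) (false ∷ V) f =
  trans (∑ˡ-allSubsets-suc n _)
        (trans (cong₂ _+_ (∑ˡ-zero (allSubsets n) (λ S → *-zeroʳ (f (true ∷ S)))) (∑ˡ-allSubsets-δ n V (f ∘ (false ∷_))))
               (+-identityˡ _))

-- Only R ⊆ S ∖ V contribute, and there are none unless V ⊆ S; then Σ_{R ⊆ S ∖ V} (-1)^|R| = [S ∖ V = ∅].
inclusion-exclusion : ∀ n (S V : Subset n) →
  ∑[ R ← allSubsets n ] -1ℤ ^ ∣ R ∣ * 𝟙 (does (R ⊆? S ×-dec V ⊆? S ─ R)) ≡ 𝟙 (does (S ≟ₛ V))
inclusion-exclusion zero    []          []          = refl
inclusion-exclusion (suc n) (false ∷ S) (true  ∷ V) =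
  trans (∑ˡ-allSubsets-suc n _)
        (cong₂ _+_ (∑ˡ-zero (allSubsets n) (λ R → *-zeroʳ (-1ℤ * -1ℤ ^ ∣ R ∣)))
                   (∑ˡ-zero (allSubsets n) excluded))
  where
  excluded : ∀ R → -1ℤ ^ ∣ R ∣ * 𝟙 (does (R ⊆? S) ∧ false) ≡ 0ℤ
  excluded R rewrite ∧-zeroʳ (does (R ⊆? S)) = *-zeroʳ (-1ℤ ^ ∣ R ∣)
inclusion-exclusion (suc n) (false ∷ S) (false ∷ V) =
  trans (∑ˡ-allSubsets-suc n _)
        (trans (cong₂ _+_ (∑ˡ-zero (allSubsets n) (λ R → *-zeroʳ (-1ℤ * -1ℤ ^ ∣ R ∣))) (inclusion-exclusion n S V))
               (+-identityˡ _))
inclusion-exclusion (suc n) (true ∷ S) (true ∷ V) =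
  trans (∑ˡ-allSubsets-suc n _)
        (trans (cong₂ _+_ (∑ˡ-zero (allSubsets n) excluded) (inclusion-exclusion n S V)) (+-identityˡ _))
  where
  excluded : ∀ R → -1ℤ * -1ℤ ^ ∣ R ∣ * 𝟙 (does (R ⊆? S) ∧ false) ≡ 0ℤ
  excluded R rewrite ∧-zeroʳ (does (R ⊆? S)) = *-zeroʳ (-1ℤ * -1ℤ ^ ∣ R ∣)
inclusion-exclusion (suc n) (true ∷ S) (false ∷ V) = begin
    ∑ˡ (allSubsets (suc n)) (λ R → -1ℤ ^ ∣ R ∣ * 𝟙 (does (R ⊆? true ∷ S ×-dec false ∷ V ⊆? (true ∷ S) ─ R)))
  ≡⟨ ∑ˡ-allSubsets-suc n _ ⟩
    (∑[ R ← allSubsets n ] -1ℤ * -1ℤ ^ ∣ R ∣ * 𝟙 (d R)) + ∑ˡ (allSubsets n) f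
  ≡⟨ cong (_+ ∑ˡ (allSubsets n) f) (trans (∑ˡ-cong (allSubsets n) (λ R → *-assoc -1ℤ (-1ℤ ^ ∣ R ∣) (𝟙 (d R))))
                                         (sym (*-∑ˡ (allSubsets n) -1ℤ f))) ⟩
    -1ℤ * ∑ˡ (allSubsets n) f + ∑ˡ (allSubsets n) f
  ≡⟨ cancel (∑ˡ (allSubsets n) f) ⟩
    0ℤ ∎
  where
  open ≡-Reasoning
  d : Subset n → Bool
  d R = does (R ⊆? S ×-dec V ⊆? S ─ R)
  f : Subset n → ℤ
  f R = -1ℤ ^ ∣ R ∣ * 𝟙 (d R)
  cancel : ∀ x → -1ℤ * x + x ≡ 0ℤ
  cancel = solve-∀

∑ˡ-upTo-δ : ∀ K c (F : ℕ → ℤ) → ∑[ m ← upTo K ] 𝟙 (does (c ℕ.≟ m)) * F m ≡ 𝟙 (does (c ℕ.<? K)) * F c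
∑ˡ-upTo-δ zero    c F = refl
∑ˡ-upTo-δ (suc K) c F = begin
    ∑ˡ (upTo (suc K)) g
  ≡⟨ cong (λ L → ∑ˡ L g) (sym (upTo-∷ʳ K)) ⟩
    ∑ˡ (upTo K ∷ʳ K) g
  ≡⟨ ∑ˡ-++ (upTo K) [ K ] g ⟩
    ∑ˡ (upTo K) g + (g K + 0ℤ)
  ≡⟨ cong₂ _+_ (∑ˡ-upTo-δ K c F) (+-identityʳ (g K)) ⟩
    𝟙 (does (c ℕ.<? K)) * F c + 𝟙 (does (c ℕ.≟ K)) * F K
  ≡⟨ <-suc-cases (c ℕ.<? K) (c ℕ.≟ K) (c ℕ.<? suc K) ⟩
    𝟙 (does (c ℕ.<? suc K)) * F c ∎
  where
  open ≡-Reasoning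
  g : ℕ → ℤ
  g m = 𝟙 (does (c ℕ.≟ m)) * F m
  <-suc-cases : (c<K? : Dec (c < K)) (c≡K? : Dec (c ≡ K)) (c<1+K? : Dec (c < suc K)) →
                𝟙 (does c<K?) * F c + 𝟙 (does c≡K?) * F K ≡ 𝟙 (does c<1+K?) * F c
  <-suc-cases (yes c<K) (yes refl) _          = ⊥-elim (ℕ.<-irrefl refl c<K)
  <-suc-cases (yes c<K) (no  _)    (yes _)    = +-identityʳ _
  <-suc-cases (yes c<K) (no  _)    (no c≮1+K) = ⊥-elim (c≮1+K (ℕ.m<n⇒m<1+n c<K))
  <-suc-cases (no  _)   (yes refl) (yes _)    = +-identityˡ _
  <-suc-cases (no  _)   (yes refl) (no c≮1+K) = ⊥-elim (c≮1+K ℕ.≤-refl)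
  <-suc-cases (no  c≮K) (no  c≢K)  (yes c<1+K) = ⊥-elim (c≢K (ℕ.≤-antisym (ℕ.≤-pred c<1+K) (ℕ.≮⇒≥ c≮K)))
  <-suc-cases (no  _)   (no  _)    (no  _)    = refl

∑ˡ-bySize : ∀ {n} K (g : ℕ → Subset n → ℤ) →
            ∑[ m ← upTo K ] ∑ˡ (subsetsOfSize n m) (g m) ≡
            ∑[ R ← allSubsets n ] 𝟙 (does (∣ R ∣ ℕ.<? K)) * g ∣ R ∣ R
∑ˡ-bySize {n} K g = begin
    ∑[ m ← upTo K ] ∑ˡ (subsetsOfSize n m) (g m)
  ≡⟨ ∑ˡ-cong (upTo K) (λ m → ∑ˡ-filter (λ R → ∣ R ∣ ℕ.≟ m) (allSubsets n) (g m)) ⟩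
    ∑[ m ← upTo K ] ∑[ R ← allSubsets n ] 𝟙 (does (∣ R ∣ ℕ.≟ m)) * g m R
  ≡⟨ ∑ˡ-comm (upTo K) (allSubsets n) _ ⟩
    ∑[ R ← allSubsets n ] ∑[ m ← upTo K ] 𝟙 (does (∣ R ∣ ℕ.≟ m)) * g m R
  ≡⟨ ∑ˡ-cong (allSubsets n) (λ R → ∑ˡ-upTo-δ K ∣ R ∣ (λ m → g m R)) ⟩
    ∑[ R ← allSubsets n ] 𝟙 (does (∣ R ∣ ℕ.<? K)) * g ∣ R ∣ R ∎
  where open ≡-Reasoning

module _ {N} (K : ℕ) (V : Subset N) {x y : Fin N} (x∈V : x ∈ V) (y∈V : y ∈ V) (x≢y : x ≢ y) where

  ∣R∣<K : ∀ {S R} → ∣ S ∣ ≡ suc K → R ⊆ S × V ⊆ S ─ R → ∣ R ∣ < K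
  ∣R∣<K {S} {R} ∣S∣≡1+K (R⊆S , V⊆S─R) = ℕ.≤-pred (begin
      2 ℕ.+ ∣ R ∣         ≤⟨ ℕ.+-monoˡ-≤ ∣ R ∣ (2≤∣p∣ (V⊆S─R x∈V) (V⊆S─R y∈V) x≢y) ⟩
      ∣ S ─ R ∣ ℕ.+ ∣ R ∣ ≡⟨ trans (∣p─q∣+∣q∣≡∣p∣ S R R⊆S) ∣S∣≡1+K ⟩
      suc K               ∎)
    where open ℕ.≤-Reasoning

  alternatingSum : Subset N → ℤ
  alternatingSum S = ∑[ m ← upTo K ] -1ℤ ^ m * (∑[ R ← subsetsOfSizeIn S m ] 𝟙 (does (V ⊆? S ─ R)))

  alternatingSum-eval : ∀ S → ∣ S ∣ ≡ suc K → alternatingSum S ≡ 𝟙 (does (S ≟ₛ V))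
  alternatingSum-eval S ∣S∣≡1+K = begin
      alternatingSum S
    ≡⟨ ∑ˡ-cong (upTo K) (λ m → cong (-1ℤ ^ m *_) (∑ˡ-filter (λ R → R ⊆? S) (subsetsOfSize N m) _)) ⟩
      ∑[ m ← upTo K ] -1ℤ ^ m * (∑[ R ← subsetsOfSize N m ] 𝟙 (does (R ⊆? S)) * 𝟙 (does (V ⊆? S ─ R)))
    ≡⟨ ∑ˡ-cong (upTo K) (λ m → trans (*-∑ˡ (subsetsOfSize N m) (-1ℤ ^ m) _)
                                      (∑ˡ-cong (subsetsOfSize N m) λ R →
                                        cong (-1ℤ ^ m *_) (sym (𝟙-∧ (does (R ⊆? S)) (does (V ⊆? S ─ R)))))) ⟩
      ∑[ m ← upTo K ] ∑[ R ← subsetsOfSize N m ] -1ℤ ^ m * 𝟙 (does (R ⊆? S ×-dec V ⊆? S ─ R))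
    ≡⟨ ∑ˡ-bySize K (λ m R → -1ℤ ^ m * 𝟙 (does (R ⊆? S ×-dec V ⊆? S ─ R))) ⟩
      ∑[ R ← allSubsets N ] 𝟙 (does (∣ R ∣ ℕ.<? K)) * (-1ℤ ^ ∣ R ∣ * 𝟙 (does (R ⊆? S ×-dec V ⊆? S ─ R)))
    ≡⟨ ∑ˡ-cong (allSubsets N) (λ R →
         𝟙-guard (∣ R ∣ ℕ.<? K) (R ⊆? S ×-dec V ⊆? S ─ R) (-1ℤ ^ ∣ R ∣) (∣R∣<K ∣S∣≡1+K)) ⟩
      ∑[ R ← allSubsets N ] -1ℤ ^ ∣ R ∣ * 𝟙 (does (R ⊆? S ×-dec V ⊆? S ─ R))
    ≡⟨ inclusion-exclusion N S V ⟩
      𝟙 (does (S ≟ₛ V)) ∎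
    where open ≡-Reasoning

  rhsCoefficient-eval : rhsCoefficient K V ≡ 𝟙 (does (∣ V ∣ ℕ.≟ suc K))
  rhsCoefficient-eval = begin
      rhsCoefficient K V
    ≡⟨ ∑ˡ-filter (λ S → ∣ S ∣ ℕ.≟ suc K) (allSubsets N) alternatingSum ⟩
      ∑[ S ← allSubsets N ] 𝟙 (does (∣ S ∣ ℕ.≟ suc K)) * alternatingSum S
    ≡⟨ ∑ˡ-cong (allSubsets N) (λ S → 𝟙-*-cong (∣ S ∣ ℕ.≟ suc K) (alternatingSum-eval S)) ⟩
      ∑[ S ← allSubsets N ] 𝟙 (does (∣ S ∣ ℕ.≟ suc K)) * 𝟙 (does (S ≟ₛ V))
    ≡⟨ ∑ˡ-allSubsets-δ N V (λ S → 𝟙 (does (∣ S ∣ ℕ.≟ suc K))) ⟩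
      𝟙 (does (∣ V ∣ ℕ.≟ suc K)) ∎
    where open ≡-Reasoning

Adjacent : ∀ {N k} → Mat N → Vec (Fin N) (suc k) → Set
Adjacent {k = k} A w = ∀ (t : Fin k) → A (lookup w (inject₁ t)) (lookup w (suc t)) ≡ 1ℤ

adjacent? : ∀ {N k} (A : Mat N) (w : Vec (Fin N) (suc k)) → Dec (Adjacent A w)
adjacent? A w = all? (λ t → A (lookup w (inject₁ t)) (lookup w (suc t)) ℤ.≟ 1ℤ)

adjacent⇒weight≡1 : ∀ {N k} (A : Mat N) (w : Vec (Fin N) (suc k)) → Adjacent A w → weight A w ≡ 1ℤ
adjacent⇒weight≡1 A (x ∷ [])    _   = refl
adjacent⇒weight≡1 A (x ∷ y ∷ w) adj = cong₂ _*_ (adj zero) (adjacent⇒weight≡1 A (y ∷ w) (adj ∘ suc))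

module _ {N} (A : Mat N) (A01 : ∀ i j → A i j ≡ 0ℤ ⊎ A i j ≡ 1ℤ) where

  ¬adjacent⇒weight≡0 : ∀ {k} (w : Vec (Fin N) (suc k)) → ¬ Adjacent A w → weight A w ≡ 0ℤ
  ¬adjacent⇒weight≡0 (x ∷ [])    ¬adj = ⊥-elim (¬adj λ ())
  ¬adjacent⇒weight≡0 (x ∷ y ∷ w) ¬adj with A01 x y
  ... | inj₁ Axy≡0 = cong (_* weight A (y ∷ w)) Axy≡0
  ... | inj₂ Axy≡1 =
    cong₂ _*_ Axy≡1 (¬adjacent⇒weight≡0 (y ∷ w) λ adj → ¬adj λ { zero → Axy≡1 ; (suc t) → adj t })

  ¬adjacent⇒walkTerm≡0 : ∀ {k} i j (w : Vec (Fin N) (suc k)) → ¬ Adjacent A w → walkTerm A i j w ≡ 0ℤ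
  ¬adjacent⇒walkTerm≡0 {k} i j w ¬adj =
    trans (cong (λ z → h * (l * z)) (¬adjacent⇒weight≡0 w ¬adj)) (annihilate h l)
    where
    h = 𝟙 (does (lookup w zero ≟ i))
    l = 𝟙 (does (lookup w (fromℕ k) ≟ j))
    annihilate : ∀ a b → a * (b * 0ℤ) ≡ 0ℤ
    annihilate = solve-∀

  module _ (A-irreflexive : ∀ i → A i i ≡ 0ℤ) (k : ℕ) (i j : Fin N) where

    private
      K = suc k

    adjacent⇒w₀≢w₁ : (w : Vec (Fin N) (suc K)) → Adjacent A w → lookup w zero ≢ lookup w (suc zero)
    adjacent⇒w₀≢w₁ w adj w₀≡w₁
      with trans (sym (A-irreflexive (lookup w zero))) (trans (cong (A (lookup w zero)) w₀≡w₁) (adj zero))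
    ... | ()

    adjacent⇒isPath⇔ : (w : Vec (Fin N) (suc K)) → Adjacent A w →
                       IsPath A K i j w ⇔ (lookup w zero ≡ i × lookup w (fromℕ K) ≡ j × ∣ nodes w ∣ ≡ suc K)
    adjacent⇒isPath⇔ w adj =
      mk⇔ (λ (w₀≡i , wₖ≡j , _ , distinct) → w₀≡i , wₖ≡j , distinct⇒∣nodes∣≡length w distinct)
          (λ (w₀≡i , wₖ≡j , ∣nodes∣≡) → w₀≡i , wₖ≡j , adj , ∣nodes∣≡length⇒distinct w ∣nodes∣≡)

    𝟙-isPath : (w : Vec (Fin N) (suc K)) → 𝟙 (does (isPath? A K i j w)) ≡ walkTerm A i j w * rhsCoefficient K (nodes w)
    𝟙-isPath w with adjacent? A w
    ... | no ¬adj = begin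
        𝟙 (does (isPath? A K i j w))   ≡⟨ cong 𝟙 (dec-false (isPath? A K i j w) (λ (_ , _ , adj , _) → ¬adj adj)) ⟩
        0ℤ                             ≡⟨ sym (cong (_* rhsCoefficient K (nodes w)) (¬adjacent⇒walkTerm≡0 i j w ¬adj)) ⟩
        walkTerm A i j w * rhsCoefficient K (nodes w) ∎
      where open ≡-Reasoning
    ... | yes adj = begin
        𝟙 (does (isPath? A K i j w))
      ≡⟨ cong 𝟙 (does-⇔ (adjacent⇒isPath⇔ w adj) (isPath? A K i j w) (w₀≟i ×-dec wₖ≟j ×-dec ∣nodes∣≟)) ⟩
        𝟙 (does w₀≟i ∧ (does wₖ≟j ∧ does ∣nodes∣≟))
      ≡⟨ trans (𝟙-∧ (does w₀≟i) _) (cong (𝟙 (does w₀≟i) *_) (𝟙-∧ (does wₖ≟j) (does ∣nodes∣≟))) ⟩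
        𝟙 (does w₀≟i) * (𝟙 (does wₖ≟j) * 𝟙 (does ∣nodes∣≟))
      ≡⟨ reassoc (𝟙 (does w₀≟i)) (𝟙 (does wₖ≟j)) (𝟙 (does ∣nodes∣≟)) ⟩
        𝟙 (does w₀≟i) * (𝟙 (does wₖ≟j) * 1ℤ) * 𝟙 (does ∣nodes∣≟)
      ≡⟨ cong₂ (λ a b → 𝟙 (does w₀≟i) * (𝟙 (does wₖ≟j) * a) * b)
               (sym (adjacent⇒weight≡1 A w adj))
               (sym (rhsCoefficient-eval K (nodes w) (lookup∈nodes w zero) (lookup∈nodes w (suc zero))
                                         (adjacent⇒w₀≢w₁ w adj))) ⟩
        walkTerm A i j w * rhsCoefficient K (nodes w) ∎
      where
      open ≡-Reasoning
      w₀≟i = lookup w zero ≟ i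
      wₖ≟j = lookup w (fromℕ K) ≟ j
      ∣nodes∣≟ = ∣ nodes w ∣ ℕ.≟ suc K
      reassoc : ∀ a b c → a * (b * c) ≡ a * (b * 1ℤ) * c
      reassoc = solve-∀

theorem4 : (N : ℕ) (A : Mat N) →
    (∀ i j → A i j ≡ 0ℤ ⊎ A i j ≡ 1ℤ) →
    (∀ i j → A i j ≡ A j i) →
    (∀ i → A i i ≡ 0ℤ) →
    (k : ℕ) → 1 ≤ k → k ≤ N ∸ 1 →
    (i j : Fin N) → P A k i j ≡ rhs A k i j
theorem4 N A A01 _ A-irreflexive (suc k) _ _ i j = begin
    P A K i j                                               ≡⟨ length-filter (isPath? A K i j) W ⟩
    ∑[ w ← W ] 𝟙 (does (isPath? A K i j w))                 ≡⟨ ∑ˡ-cong W (𝟙-isPath A A01 A-irreflexive k i j) ⟩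
    ∑[ w ← W ] walkTerm A i j w * rhsCoefficient K (nodes w) ≡⟨ sym (rhs≡walkSum A k i j) ⟩
    rhs A K i j                                             ∎
  where
  open ≡-Reasoning
  K = suc k
  W = allSeqs N (suc K)
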